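{- Let $d \geq 1$. Let $\mathcal{F}$ be a finite family of sets, each of size at most $d$, and let $\mathcal{H}$ be a family of minimal covers of $\mathcal{F}$, each of which has at most $d$ elements. Then $|\bigcup \mathcal{H}| \leq b(d)$. Moreover this inequality is best possible: there exist such $\mathcal{F}$ and $\mathcal{H}$ with $|\bigcup \mathcal{H}| = b(d)$.
   Context: A set $C$ is a cover of a family $\mathcal{F}$ if $C \cap E \neq \emptyset$ for every $E \in \mathcal{F}$; it is a minimal cover if no proper subset of $C$ is a cover of $\mathcal{F}$. For a finite graph $G$, a family of subsets of $V(G)$ is an edge cover of $G$ iff every edge of $G$ is included in some member; it is a minimal edge cover iff no proper subfamily is an edge cover; it has degree $d$ if every vertex lies in at most $d$ members. $b(d)$ is the maximum cardinality of a minimal edge cover of degree $d$ of a complete bipartite graph. -}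

module Defs where

open import Data.Nat using (ℕ; _≤_)
open import Data.Bool using (Bool)
open import Data.Fin using (Fin)
open import Data.Fin.Subset using (Subset; _∈_; _⊆_; _∩_; Nonempty; ⊤; ∣_∣)
open import Data.Fin.Subset.Properties using (_∈?_)
open import Data.List using (List)
open import Data.List.Relation.Unary.All using (All)
open import Data.Product using (Σ; ∃; _×_; proj₁; proj₂)
open import Data.Vec using (tabulate)
open import Relation.Nullary using (does)
open import Relation.Binary.PropositionalEquality using (_≡_)

IsCover : ∀ {n} → List (Subset n) → Subset n → Set
IsCover F C = All (λ E → Nonempty (C ∩ E)) F

IsMinimalCover : ∀ {n} → List (Subset n) → Subset n → Set
IsMinimalCover F C = IsCover F C × (∀ C′ → C′ ⊆ C → IsCover F C′ → C ⊆ C′)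

-- Complete bipartite graph K_{m,n} with vertex set Fin m ⊎ Fin n.
-- A subset of its vertex set is a pair (A , B) with A ⊆ Fin m, B ⊆ Fin n.
-- A family of k such subsets is indexed by Fin k.

BipFamily : ℕ → ℕ → ℕ → Set
BipFamily m n k = Fin k → Subset m × Subset n

IsEdgeCoverSub : ∀ {m n k} → BipFamily m n k → Subset k → Set
IsEdgeCoverSub {m} {n} {k} 𝒞 S =
  (i : Fin m) (j : Fin n) →
    ∃ λ (t : Fin k) → t ∈ S × i ∈ proj₁ (𝒞 t) × j ∈ proj₂ (𝒞 t)

IsEdgeCover : ∀ {m n k} → BipFamily m n k → Set
IsEdgeCover 𝒞 = IsEdgeCoverSub 𝒞 ⊤

IsMinimalEdgeCover : ∀ {m n k} → BipFamily m n k → Set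
IsMinimalEdgeCover {k = k} 𝒞 =
  IsEdgeCover 𝒞 × (∀ (S : Subset k) → IsEdgeCoverSub 𝒞 S → ⊤ ⊆ S)

HasDegree : ∀ {m n k} → ℕ → BipFamily m n k → Set
HasDegree {m} {n} {k} d 𝒞 =
  ((i : Fin m) → ∣ tabulate (λ t → does (i ∈? proj₁ (𝒞 t))) ∣ ≤ d) ×
  ((j : Fin n) → ∣ tabulate (λ t → does (j ∈? proj₂ (𝒞 t))) ∣ ≤ d)

-- IsB d N : N = b(d), the maximum cardinality of a minimal edge cover of
-- degree d of a complete bipartite graph (attained, and an upper bound).
IsB : ℕ → ℕ → Set
IsB d N =
  (Σ ℕ λ m → Σ ℕ λ n → Σ (BipFamily m n N) λ 𝒞 →
      IsMinimalEdgeCover 𝒞 × HasDegree d 𝒞)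
  × (∀ m n k (𝒞 : BipFamily m n k) →
      IsMinimalEdgeCover 𝒞 → HasDegree d 𝒞 → k ≤ N)

{-# OPTIONS --safe #-}
-- Points of ⋃ H correspond to the members of an edge cover of K_{|F|,|H|}: the point x
-- becomes the member ({E ∈ F ∣ x ∈ E} , {C ∈ H ∣ x ∈ C}).  Each C ∈ H meets each E ∈ F, so
-- this is an edge cover; minimality of C gives every x ∈ C a set E with C ∩ E = {x}, i.e. a
-- private edge, so the edge cover is minimal; and the degrees are |E| and |C|, both at most d.
-- Conversely, for a minimal edge cover of degree d with N members, take for F the vertices of
-- one side (as sets of members) and shrink each vertex of the other side, which covers F, to a
-- minimal cover.  A member whose private edge is (E , C) is the only possible point of the
-- shrunken C meeting E, so it survives and the union has all N members.
module Submission where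

open import Defs
open import Data.Bool.Base using (true)
open import Data.Empty using (⊥-elim)
open import Data.Fin.Base using (Fin; zero; suc)
open import Data.Fin.Properties using (any?; all?; ¬∀⟶∃¬; suc-injective; _≟_)
open import Data.Fin.Subset
  using (Subset; inside; outside; _∈_; _∉_; _⊆_; _⊂_; _∩_; _-_; ⋃; ∣_∣; ⊤; ⁅_⁆; Nonempty)
open import Data.Fin.Subset.Induction using (⊂-wellFounded; Acc; acc)
open import Data.Fin.Subset.Properties
open import Data.List.Base as List using (List; length; lookup)
open import Data.List.Membership.Propositional using () renaming (_∈_ to _∈ₗ_)
open import Data.List.Membership.Propositional.Properties using (∈-lookup; ∈-tabulate⁺)
open import Data.List.Relation.Unary.All as All using (All)
open import Data.List.Relation.Unary.All.Properties using (tabulate⁺; tabulate⁻)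
open import Data.List.Relation.Unary.All.Properties.Core using (¬All⇒Any¬)
open import Data.List.Relation.Unary.Any as Any using (here; there)
open import Data.List.Relation.Unary.Any.Properties using (lookup-index)
open import Data.Nat.Base using (ℕ; suc; _≤_)
open import Data.Nat.Properties using (≤-trans; module ≤-Reasoning)
open import Data.Product using (Σ; ∃; ∃₂; _×_; _,_; proj₁; proj₂)
open import Data.Sum using (inj₁; inj₂)
open import Data.Vec.Base as Vec using ([]; _∷_)
open import Data.Vec.Properties using (lookup∘tabulate; tabulate-cong; []=⇒lookup; lookup⇒[]=)
open import Function.Base using (_∘_; id)
open import Function.Bundles using (mk⇔)
open import Level using (Level)
open import Relation.Binary.PropositionalEquality using (_≡_; refl; sym; trans; cong; subst)
open import Relation.Nullary using (Dec; yes; no; does; ¬_)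
open import Relation.Nullary.Decidable using (_×-dec_; dec-true; does-⇔; decidable-stable)
open import Relation.Unary using (Pred; Decidable)

private
  variable
    ℓ : Level
    m n k : ℕ

fromPred : {P : Pred (Fin n) ℓ} → Decidable P → Subset n
fromPred P? = Vec.tabulate (λ x → does (P? x))

∈-fromPred⁺ : {P : Pred (Fin n) ℓ} (P? : Decidable P) {x : Fin n} → P x → x ∈ fromPred P?
∈-fromPred⁺ P? {x} px = lookup⇒[]= x _ (trans (lookup∘tabulate _ x) (dec-true (P? x) px))

∈-fromPred⁻ : {P : Pred (Fin n) ℓ} (P? : Decidable P) {x : Fin n} → x ∈ fromPred P? → P x
∈-fromPred⁻ P? {x} x∈ = witness (P? x) (trans (sym (lookup∘tabulate _ x)) ([]=⇒lookup x∈))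
  where
  witness : ∀ {A : Set ℓ} (a? : Dec A) → does a? ≡ true → A
  witness (yes a) _ = a

-- HasDegree d 𝒞 unfolds to bounds on ∣ transpose (proj₁ ∘ 𝒞) i ∣ and ∣ transpose (proj₂ ∘ 𝒞) j ∣.
transpose : (Fin m → Subset n) → Fin n → Subset m
transpose 𝒜 x = fromPred (λ i → x ∈? 𝒜 i)

∈-transpose⁺ : {𝒜 : Fin m → Subset n} {i : Fin m} {x : Fin n} → x ∈ 𝒜 i → i ∈ transpose 𝒜 x
∈-transpose⁺ {𝒜 = 𝒜} {x = x} = ∈-fromPred⁺ (λ i → x ∈? 𝒜 i)

∈-transpose⁻ : {𝒜 : Fin m → Subset n} {i : Fin m} {x : Fin n} → i ∈ transpose 𝒜 x → x ∈ 𝒜 i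
∈-transpose⁻ {𝒜 = 𝒜} {x = x} = ∈-fromPred⁻ (λ i → x ∈? 𝒜 i)

preimage : (Fin k → Fin n) → Subset n → Subset k
preimage f q = fromPred (λ t → f t ∈? q)

transpose-∘ : (𝒜 : Fin m → Subset n) (f : Fin k → Fin n) (i : Fin m) →
              transpose (transpose 𝒜 ∘ f) i ≡ preimage f (𝒜 i)
transpose-∘ 𝒜 f i = tabulate-cong λ t →
  does-⇔ (mk⇔ (∈-transpose⁻ {𝒜 = 𝒜}) (∈-transpose⁺ {𝒜 = 𝒜})) (i ∈? transpose 𝒜 (f t)) (f t ∈? 𝒜 i)

enumerate : (p : Subset n) → Fin ∣ p ∣ → Fin n
enumerate (inside  ∷ p) zero    = zero
enumerate (inside  ∷ p) (suc t) = suc (enumerate p t)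
enumerate (outside ∷ p) t       = suc (enumerate p t)

enumerate-∈ : (p : Subset n) (t : Fin ∣ p ∣) → enumerate p t ∈ p
enumerate-∈ (inside  ∷ p) zero    = Vec.here
enumerate-∈ (inside  ∷ p) (suc t) = Vec.there (enumerate-∈ p t)
enumerate-∈ (outside ∷ p) t       = Vec.there (enumerate-∈ p t)

enumerate-injective : (p : Subset n) {s t : Fin ∣ p ∣} → enumerate p s ≡ enumerate p t → s ≡ t
enumerate-injective (inside  ∷ p) {zero}  {zero}  _  = refl
enumerate-injective (inside  ∷ p) {suc s} {suc t} eq =
  cong suc (enumerate-injective p (suc-injective eq))
enumerate-injective (outside ∷ p)                 eq = enumerate-injective p (suc-injective eq)

enumerate-onto : (p : Subset n) {x : Fin n} → x ∈ p → ∃ λ t → enumerate p t ≡ x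
enumerate-onto (inside ∷ p) Vec.here = zero , refl
enumerate-onto (inside ∷ p) (Vec.there x∈p) =
  let t , eq = enumerate-onto p x∈p in suc t , cong suc eq
enumerate-onto (outside ∷ p) (Vec.there x∈p) =
  let t , eq = enumerate-onto p x∈p in t , cong suc eq

∣preimage-enumerate∣ : (p q : Subset n) → ∣ preimage (enumerate p) q ∣ ≡ ∣ p ∩ q ∣
∣preimage-enumerate∣ []            []            = refl
∣preimage-enumerate∣ (inside  ∷ p) (inside  ∷ q) = cong suc (∣preimage-enumerate∣ p q)
∣preimage-enumerate∣ (inside  ∷ p) (outside ∷ q) = ∣preimage-enumerate∣ p q
∣preimage-enumerate∣ (outside ∷ p) (_       ∷ q) = ∣preimage-enumerate∣ p q

∣transpose-enumerate∣ : (𝒜 : Fin m → Subset n) (p : Subset n) (i : Fin m) →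
                        ∣ transpose (transpose 𝒜 ∘ enumerate p) i ∣ ≡ ∣ p ∩ 𝒜 i ∣
∣transpose-enumerate∣ 𝒜 p i =
  trans (cong ∣_∣ (transpose-∘ 𝒜 (enumerate p) i)) (∣preimage-enumerate∣ p (𝒜 i))

x∉p-x : (p : Subset n) (x : Fin n) → x ∉ p - x
x∉p-x (_ ∷ p) zero    ()
x∉p-x (_ ∷ p) (suc x) (Vec.there x∈) = x∉p-x p x x∈

∈-⋃⁺ : {H : List (Subset n)} {x : Fin n} {C : Subset n} → x ∈ C → C ∈ₗ H → x ∈ ⋃ H
∈-⋃⁺ x∈C (here refl)  = x∈p∪q⁺ (inj₁ x∈C)
∈-⋃⁺ x∈C (there C∈H) = x∈p∪q⁺ (inj₂ (∈-⋃⁺ x∈C C∈H))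

∈-⋃⁻ : (H : List (Subset n)) {x : Fin n} → x ∈ ⋃ H → ∃ λ j → x ∈ lookup H j
∈-⋃⁻ List.[]      x∈ = ⊥-elim (∉⊥ x∈)
∈-⋃⁻ (C List.∷ H) x∈ with x∈p∪q⁻ C (⋃ H) x∈
... | inj₁ x∈C  = zero , x∈C
... | inj₂ x∈⋃H = let j , x∈Cⱼ = ∈-⋃⁻ H x∈⋃H in suc j , x∈Cⱼ

cover? : (F : List (Subset n)) → Decidable (IsCover F)
cover? F C = All.all? (λ E → nonempty? (C ∩ E)) F

cover-mono : {F : List (Subset n)} {C D : Subset n} → C ⊆ D → IsCover F C → IsCover F D
cover-mono {C = C} C⊆D = All.map λ {E} (x , x∈C∩E) →
  let x∈C , x∈E = x∈p∩q⁻ C E x∈C∩E in x , x∈p∩q⁺ (C⊆D x∈C , x∈E)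

minimalCover⇒privateSet : {F : List (Subset n)} {C : Subset n} {x : Fin n} →
  IsMinimalCover F C → x ∈ C → ∃ λ i → ∀ {y} → y ∈ C → y ∈ lookup F i → y ≡ x
minimalCover⇒privateSet {F = F} {C} {x} (_ , minimal) x∈C =
  Any.index missed , λ {y} y∈C y∈E → decidable-stable (y ≟ x) λ y≢x →
    lookup-index missed (y , x∈p∩q⁺ (x∈p∧x≢y⇒x∈p-y y∈C y≢x , y∈E))
  where
  ¬cover : ¬ IsCover F (C - x)
  ¬cover cover = x∉p-x C x (minimal (C - x) (p─q⊆p C ⁅ x ⁆) cover x∈C)
  missed : Any.Any (λ E → ¬ Nonempty ((C - x) ∩ E)) F
  missed = ¬All⇒Any¬ (λ E → nonempty? ((C - x) ∩ E)) F ¬cover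

irreducible⇒minimalCover : {F : List (Subset n)} {C : Subset n} →
  IsCover F C → (∀ {x} → x ∈ C → ¬ IsCover F (C - x)) → IsMinimalCover F C
irreducible⇒minimalCover {C = C} cover irreducible = cover , λ C′ C′⊆C coverC′ {y} y∈C →
  decidable-stable (y ∈? C′) λ y∉C′ → irreducible y∈C (cover-mono (λ z∈C′ →
    x∈p∧x≢y⇒x∈p-y (C′⊆C z∈C′) λ { refl → y∉C′ z∈C′ }) coverC′)

minimalSubcover : {F : List (Subset n)} {C : Subset n} →
  IsCover F C → ∃ λ C′ → C′ ⊆ C × IsMinimalCover F C′
minimalSubcover {n = n} {F = F} = shrink _ (⊂-wellFounded _)
  where
  shrink : (C : Subset n) → Acc _⊂_ C → IsCover F C → ∃ λ C′ → C′ ⊆ C × IsMinimalCover F C′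
  shrink C (acc smaller) cover with any? (λ x → x ∈? C ×-dec cover? F (C - x))
  ... | yes (x , x∈C , cover′) =
    let C′ , C′⊆C-x , minimal = shrink (C - x) (smaller (x∈p⇒p-x⊂p x∈C)) cover′
    in C′ , (λ y∈C′ → p─q⊆p C ⁅ x ⁆ (C′⊆C-x y∈C′)) , minimal
  ... | no ¬redundant =
    C , id , irreducible⇒minimalCover cover λ x∈C cover′ → ¬redundant (_ , x∈C , cover′)

minimalEdgeCover⇒privateEdge : {𝒞 : BipFamily m n k} → IsMinimalEdgeCover 𝒞 → (t : Fin k) →
  ∃₂ λ i j → ∀ s → i ∈ proj₁ (𝒞 s) → j ∈ proj₂ (𝒞 s) → s ≡ t
minimalEdgeCover⇒privateEdge {m = m} {n = n} {𝒞 = 𝒞} (_ , minimal) t =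
  let i , ¬∀j = ¬∀⟶∃¬ m _ (λ i → all? (coveredWithout? i)) ¬cover
      j , ¬covered = ¬∀⟶∃¬ n _ (coveredWithout? i) ¬∀j
  in i , j , λ s i∈Aₛ j∈Bₛ → decidable-stable (s ≟ t) λ s≢t →
       ¬covered (s , x∈p∧x≢y⇒x∈p-y ∈⊤ s≢t , i∈Aₛ , j∈Bₛ)
  where
  coveredWithout? : ∀ i j → Dec (∃ λ s → s ∈ ⊤ - t × i ∈ proj₁ (𝒞 s) × j ∈ proj₂ (𝒞 s))
  coveredWithout? i j = any? λ s → s ∈? ⊤ - t ×-dec i ∈? proj₁ (𝒞 s) ×-dec j ∈? proj₂ (𝒞 s)
  ¬cover : ¬ IsEdgeCoverSub 𝒞 (⊤ - t)
  ¬cover coverWithout = x∉p-x ⊤ t (minimal (⊤ - t) coverWithout ∈⊤)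

module Incidence (F H : List (Subset n)) where

  family : BipFamily (length F) (length H) ∣ ⋃ H ∣
  family t = transpose (lookup F) (enumerate (⋃ H) t) , transpose (lookup H) (enumerate (⋃ H) t)

  isEdgeCover : All (IsCover F) H → IsEdgeCover family
  isEdgeCover coverH i j
    with x , x∈Cⱼ∩Eᵢ ← All.lookup (All.lookup coverH (∈-lookup j)) (∈-lookup i)
    with x∈Cⱼ , x∈Eᵢ ← x∈p∩q⁻ (lookup H j) (lookup F i) x∈Cⱼ∩Eᵢ
    with t , refl ← enumerate-onto (⋃ H) (∈-⋃⁺ x∈Cⱼ (∈-lookup {xs = H} j))
    = t , ∈⊤ , ∈-transpose⁺ x∈Eᵢ , ∈-transpose⁺ x∈Cⱼ

  isMinimalEdgeCover : All (IsMinimalCover F) H → IsMinimalEdgeCover family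
  isMinimalEdgeCover minimalH = isEdgeCover (All.map proj₁ minimalH) , λ S coverS {t} _ →
    let j , x∈Cⱼ = ∈-⋃⁻ H (enumerate-∈ (⋃ H) t)
        i , unique = minimalCover⇒privateSet (All.lookup minimalH (∈-lookup j)) x∈Cⱼ
        s , s∈S , i∈Aₛ , j∈Bₛ = coverS i j
    in subst (_∈ S) (enumerate-injective (⋃ H) (unique (∈-transpose⁻ j∈Bₛ) (∈-transpose⁻ i∈Aₛ))) s∈S

  hasDegree : {d : ℕ} → All (λ E → ∣ E ∣ ≤ d) F → All (λ C → ∣ C ∣ ≤ d) H → HasDegree d family
  hasDegree {d} boundF boundH = degree≤ boundF , degree≤ boundH
    where
    degree≤ : {L : List (Subset n)} → All (λ E → ∣ E ∣ ≤ d) L → (i : Fin (length L)) →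
              ∣ transpose (transpose (lookup L) ∘ enumerate (⋃ H)) i ∣ ≤ d
    degree≤ {L} bound i = begin
      ∣ transpose (transpose (lookup L) ∘ enumerate (⋃ H)) i ∣ ≡⟨ ∣transpose-enumerate∣ (lookup L) (⋃ H) i ⟩
      ∣ ⋃ H ∩ lookup L i ∣                                    ≤⟨ ∣p∩q∣≤∣q∣ (⋃ H) (lookup L i) ⟩
      ∣ lookup L i ∣                                          ≤⟨ All.lookup bound (∈-lookup i) ⟩
      d                                                       ∎
      where open ≤-Reasoning

module Dual (𝒞 : BipFamily m n k) where

  rows : List (Subset k)
  rows = List.tabulate (transpose (proj₁ ∘ 𝒞))

  column : Fin n → Subset k
  column = transpose (proj₂ ∘ 𝒞)

  column-isCover : IsEdgeCover 𝒞 → (j : Fin n) → IsCover rows (column j)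
  column-isCover cover j = tabulate⁺ λ i →
    let t , _ , i∈Aₜ , j∈Bₜ = cover i j
    in t , x∈p∩q⁺ (∈-transpose⁺ {𝒜 = proj₂ ∘ 𝒞} j∈Bₜ , ∈-transpose⁺ {𝒜 = proj₁ ∘ 𝒞} i∈Aₜ)

  privateEdge∈cover : {t : Fin k} {i : Fin m} {j : Fin n} →
    (∀ s → i ∈ proj₁ (𝒞 s) → j ∈ proj₂ (𝒞 s) → s ≡ t) →
    {C : Subset k} → C ⊆ column j → IsCover rows C → t ∈ C
  privateEdge∈cover {i = i} unique {C} C⊆columnⱼ coverC =
    let s , s∈C∩rowᵢ = tabulate⁻ coverC i
        s∈C , s∈rowᵢ = x∈p∩q⁻ C _ s∈C∩rowᵢ
    in subst (_∈ C) (unique s (∈-transpose⁻ {𝒜 = proj₁ ∘ 𝒞} s∈rowᵢ)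
                              (∈-transpose⁻ {𝒜 = proj₂ ∘ 𝒞} (C⊆columnⱼ s∈C))) s∈C

  minimalCovers : {d : ℕ} → IsMinimalEdgeCover 𝒞 → HasDegree d 𝒞 →
    Σ (List (Subset k)) λ F → Σ (List (Subset k)) λ H →
      All (λ E → ∣ E ∣ ≤ d) F ×
      All (λ C → IsMinimalCover F C × ∣ C ∣ ≤ d) H ×
      ∣ ⋃ H ∣ ≡ k
  minimalCovers {d} isMinimal@(cover , _) (degreeA , degreeB) =
    rows , List.tabulate C′ , tabulate⁺ degreeA , tabulate⁺ C′-minimal , ∣⋃H∣≡k
    where
    subcover : ∀ j → ∃ λ C → C ⊆ column j × IsMinimalCover rows C
    subcover j = minimalSubcover (column-isCover cover j)

    C′ : Fin n → Subset k
    C′ = proj₁ ∘ subcover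

    C′-minimal : ∀ j → IsMinimalCover rows (C′ j) × ∣ C′ j ∣ ≤ d
    C′-minimal j =
      let _ , C′⊆columnⱼ , minimal = subcover j
      in minimal , ≤-trans (p⊆q⇒∣p∣≤∣q∣ C′⊆columnⱼ) (degreeB j)

    everyMember∈⋃H : ⊤ ⊆ ⋃ (List.tabulate C′)
    everyMember∈⋃H {t} _ =
      let i , j , unique = minimalEdgeCover⇒privateEdge isMinimal t
          _ , C′⊆columnⱼ , (coverC′ , _) = subcover j
      in ∈-⋃⁺ (privateEdge∈cover unique C′⊆columnⱼ coverC′) (∈-tabulate⁺ j)

    ∣⋃H∣≡k : ∣ ⋃ (List.tabulate C′) ∣ ≡ k
    ∣⋃H∣≡k = trans (cong ∣_∣ (⊆-antisym ⊆⊤ everyMember∈⋃H)) (∣⊤∣≡n k)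

theorem1p4 : (d : ℕ) → 1 ≤ d → (N : ℕ) → IsB d N →
    ((n : ℕ) (F : List (Subset n)) (H : List (Subset n)) →
       All (λ E → ∣ E ∣ ≤ d) F →
       All (λ C → IsMinimalCover F C × ∣ C ∣ ≤ d) H →
       ∣ ⋃ H ∣ ≤ N)
    ×
    (Σ ℕ λ n → Σ (List (Subset n)) λ F → Σ (List (Subset n)) λ H →
       All (λ E → ∣ E ∣ ≤ d) F ×
       All (λ C → IsMinimalCover F C × ∣ C ∣ ≤ d) H ×
       ∣ ⋃ H ∣ ≡ N)
-- Neither direction needs 1 ≤ d.
theorem1p4 d _ N ((_ , _ , 𝒞 , isMinimal , degree) , bound) =
  upper , N , Dual.minimalCovers 𝒞 isMinimal degree
  where
  upper : (n : ℕ) (F H : List (Subset n)) → All (λ E → ∣ E ∣ ≤ d) F →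
          All (λ C → IsMinimalCover F C × ∣ C ∣ ≤ d) H → ∣ ⋃ H ∣ ≤ N
  upper _ F H boundF minimalH =
    bound _ _ _ family
      (isMinimalEdgeCover (All.map proj₁ minimalH))
      (hasDegree boundF (All.map proj₂ minimalH))
    where open Incidence F H
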